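{- Let $t$ be a BCCS($A$) term. (1) If $t\not\xrightarrow{\tau}$, then A1-4+WIF1-2 $\vdash t\approx t'$ for some BCCSP($A$) term $t'$. (2) If $t\xrightarrow{\tau}$, then A1-4+WIF1-2 $\vdash t\approx\sum_{i\in I}\tau t_i$ where $I$ is a finite nonempty set and all $t_i$ are BCCSP($A$) terms.
   Context: $A$ is a nonempty countable set of actions, $\tau\notin A$, $A_\tau=A\cup\{\tau\}$. BCCS($A$) terms: $t::=0\mid x\mid\alpha t\mid t+t$ ($x$ a variable, $\alpha\in A_\tau$); BCCSP($A$) terms are those with no $\tau$-prefix. Transitions: $\alpha t\xrightarrow{\alpha}t$; if $t\xrightarrow{\alpha}t'$ then $t+u\xrightarrow{\alpha}t'$ and $u+t\xrightarrow{\alpha}t'$; variables have no transitions; $t\xrightarrow{\tau}$ means $t\xrightarrow{\tau}t'$ for some $t'$. Derivability is in equational logic (reflexivity, symmetry, transitivity, substitution instances, closure under contexts). A1: $x+y\approx y+x$; A2: $(x+y)+z\approx x+(y+z)$; A3: $x+x\approx x$; A4: $x+0\approx x$; WIF1: $\alpha(\tau x+\tau y)\approx\alpha x+\alpha y$ for each $\alpha\in A_\tau$; WIF2: $\tau x+y\approx\tau x+\tau(x+y)$. -}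

module Defs where

open import Data.Nat using (ℕ)
open import Data.Product using (Σ; ∃; _×_; _,_)
open import Data.List.NonEmpty using (List⁺; _∷_)
open import Data.List using (List; []; _∷_)
open import Data.List.Relation.Unary.All using (All)
open import Function.Definitions using (Injective)
open import Relation.Binary.PropositionalEquality using (_≡_)
open import Relation.Nullary using (¬_)

Var : Set
Var = ℕ

module BCCS (A : Set) where

  data Act : Set where
    act : A → Act
    τ   : Act

  data Term : Set where
    𝟘    : Term
    var  : Var → Term
    _·_  : Act → Term → Term
    _⊕_  : Term → Term → Term

  infixr 6 _⊕_
  infixr 7 _·_

  data IsBCCSP : Term → Set where
    𝟘  : IsBCCSP 𝟘
    var : ∀ x → IsBCCSP (var x)
    pre : ∀ a {t} → IsBCCSP t → IsBCCSP (act a · t)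
    sum : ∀ {t u} → IsBCCSP t → IsBCCSP u → IsBCCSP (t ⊕ u)

  data _—⟨_⟩→_ : Term → Act → Term → Set where
    pref : ∀ α t → (α · t) —⟨ α ⟩→ t
    sumˡ : ∀ {t u α t'} → t —⟨ α ⟩→ t' → (t ⊕ u) —⟨ α ⟩→ t'
    sumʳ : ∀ {t u α t'} → t —⟨ α ⟩→ t' → (u ⊕ t) —⟨ α ⟩→ t'

  CanTau : Term → Set
  CanTau t = ∃ λ t' → t —⟨ τ ⟩→ t'

  Subst : Set
  Subst = Var → Term

  _[_] : Term → Subst → Term
  𝟘 [ σ ] = 𝟘
  var x [ σ ] = σ x
  (α · t) [ σ ] = α · (t [ σ ])
  (t ⊕ u) [ σ ] = (t [ σ ]) ⊕ (u [ σ ])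

  x y z : Term
  x = var 0
  y = var 1
  z = var 2

  data Axiom : Term → Term → Set where
    A1   : Axiom (x ⊕ y) (y ⊕ x)
    A2   : Axiom ((x ⊕ y) ⊕ z) (x ⊕ (y ⊕ z))
    A3   : Axiom (x ⊕ x) x
    A4   : Axiom (x ⊕ 𝟘) x
    WIF1 : ∀ α → Axiom (α · (τ · x ⊕ τ · y)) (α · x ⊕ α · y)
    WIF2 : Axiom (τ · x ⊕ y) (τ · x ⊕ τ · (x ⊕ y))

  infix 4 _⊢≈_
  data _⊢≈_ : Term → Term → Set where
    ax    : ∀ {t u} → Axiom t u → (σ : Subst) → (t [ σ ]) ⊢≈ (u [ σ ])
    refl  : ∀ {t} → t ⊢≈ t
    sym   : ∀ {t u} → t ⊢≈ u → u ⊢≈ t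
    trans : ∀ {t u v} → t ⊢≈ u → u ⊢≈ v → t ⊢≈ v
    cong· : ∀ α {t u} → t ⊢≈ u → (α · t) ⊢≈ (α · u)
    cong⊕ : ∀ {t t' u u'} → t ⊢≈ t' → u ⊢≈ u' → (t ⊕ u) ⊢≈ (t' ⊕ u')

  -- Σ_{i∈I} τ t_i for a finite nonempty family, given as a nonempty list
  τSum′ : Term → List Term → Term
  τSum′ t [] = τ · t
  τSum′ t (u ∷ us) = τ · t ⊕ τSum′ u us

  τSum : List⁺ Term → Term
  τSum (t ∷ ts) = τSum′ t ts

  AllBCCSP : List⁺ Term → Set
  AllBCCSP (t ∷ ts) = IsBCCSP t × All IsBCCSP ts

-- The proof is a single structural induction computing a normal form.
-- The algebraic heart consists of three facts about τ-sums Σᵢ τ tᵢ: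
--   * prefixing distributes:  α · Σᵢ τ tᵢ ≈ Σᵢ α tᵢ        (WIF1, A3 and induction);
--     for α = τ this says that τ · Σᵢ τ tᵢ ≈ Σᵢ τ tᵢ;
--   * a τ-sum absorbs a summand v:  Σᵢ τ tᵢ + v ≈ Σᵢ τ tᵢ + τ (t₀ + v)   (WIF2);
--   * two τ-sums add up to the τ-sum of the concatenated families     (A2).
-- With these, a τ-free prefix a · u of a normal form becomes a BCCSP term,
-- τ · u becomes a τ-sum, and each combination of normal forms of u and v is
-- turned into a normal form of u + v.
module Submission where

open import Defs
open import Level using (0ℓ)
open import Data.Nat using (ℕ; zero; suc)
open import Data.Product using (∃; _×_; _,_)
open import Data.Empty using (⊥-elim)
open import Data.List using (List; []; _∷_; _++_)
open import Data.List.NonEmpty using (_∷_)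
open import Data.List.Relation.Unary.All using (All; []; _∷_)
import Data.List.Relation.Unary.All.Properties as All
open import Function.Definitions using (Injective)
open import Relation.Binary.Bundles using (Setoid)
open import Relation.Binary.PropositionalEquality as ≡ using (_≡_)
import Relation.Binary.Reasoning.Setoid as SetoidReasoning
open import Relation.Nullary using (¬_)

module Normalisation (A : Set) where
  open BCCS A

  derivability-setoid : Setoid 0ℓ 0ℓ
  derivability-setoid = record
    { Carrier = Term
    ; _≈_ = _⊢≈_
    ; isEquivalence = record { refl = refl ; sym = sym ; trans = trans }
    }

  open SetoidReasoning derivability-setoid

  ⟨_,_,_⟩ : Term → Term → Term → Subst
  ⟨ a , b , c ⟩ zero          = a
  ⟨ a , b , c ⟩ (suc zero)    = b
  ⟨ a , b , c ⟩ (suc (suc _)) = c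

  +-comm : ∀ a b → a ⊕ b ⊢≈ b ⊕ a
  +-comm a b = ax A1 ⟨ a , b , 𝟘 ⟩

  +-assoc : ∀ a b c → (a ⊕ b) ⊕ c ⊢≈ a ⊕ (b ⊕ c)
  +-assoc a b c = ax A2 ⟨ a , b , c ⟩

  +-idem : ∀ a → a ⊕ a ⊢≈ a
  +-idem a = ax A3 ⟨ a , 𝟘 , 𝟘 ⟩

  wif1 : ∀ α a b → α · (τ · a ⊕ τ · b) ⊢≈ α · a ⊕ α · b
  wif1 α a b = ax (WIF1 α) ⟨ a , b , 𝟘 ⟩

  wif2 : ∀ a b → τ · a ⊕ b ⊢≈ τ · a ⊕ τ · (a ⊕ b)
  wif2 a b = ax WIF2 ⟨ a , b , 𝟘 ⟩

  ≡⇒⊢≈ : ∀ {t u} → t ≡ u → t ⊢≈ u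
  ≡⇒⊢≈ ≡.refl = refl

  prefixSum : Act → Term → List Term → Term
  prefixSum α t []       = α · t
  prefixSum α t (u ∷ us) = α · t ⊕ prefixSum α u us

  prefixSum-τ : ∀ t ts → prefixSum τ t ts ≡ τSum′ t ts
  prefixSum-τ t []       = ≡.refl
  prefixSum-τ t (u ∷ us) = ≡.cong (τ · t ⊕_) (prefixSum-τ u us)

  prefix-distrib : ∀ α t ts → α · τSum′ t ts ⊢≈ prefixSum α t ts
  prefix-distrib α t [] = begin
    α · τ · t               ≈⟨ cong· α (+-idem (τ · t)) ⟨
    α · (τ · t ⊕ τ · t)     ≈⟨ wif1 α t t ⟩
    α · t ⊕ α · t           ≈⟨ +-idem (α · t) ⟩
    α · t                   ∎
  prefix-distrib α t (u ∷ us) = begin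
    α · (τ · t ⊕ τSum′ u us)            ≈⟨ cong· α (cong⊕ refl (τ-absorb u us)) ⟨
    α · (τ · t ⊕ τ · τSum′ u us)        ≈⟨ wif1 α t (τSum′ u us) ⟩
    α · t ⊕ α · τSum′ u us              ≈⟨ cong⊕ refl (prefix-distrib α u us) ⟩
    α · t ⊕ prefixSum α u us            ∎
    where
    τ-absorb : ∀ u us → τ · τSum′ u us ⊢≈ τSum′ u us
    τ-absorb u us = trans (prefix-distrib τ u us) (≡⇒⊢≈ (prefixSum-τ u us))

  prefixSum-BCCSP : ∀ a {t ts} → IsBCCSP t → All IsBCCSP ts →
                    IsBCCSP (prefixSum (act a) t ts)
  prefixSum-BCCSP a bt []         = pre a bt
  prefixSum-BCCSP a bt (bu ∷ bus) = sum (pre a bt) (prefixSum-BCCSP a bu bus)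

  τSum-absorb : ∀ t ts v → τSum′ t ts ⊕ v ⊢≈ τSum′ t ((t ⊕ v) ∷ ts)
  τSum-absorb t []       v = wif2 t v
  τSum-absorb t (u ∷ us) v = begin
    (τ · t ⊕ rest) ⊕ v              ≈⟨ +-assoc (τ · t) rest v ⟩
    τ · t ⊕ (rest ⊕ v)              ≈⟨ cong⊕ refl (+-comm rest v) ⟩
    τ · t ⊕ (v ⊕ rest)              ≈⟨ +-assoc (τ · t) v rest ⟨
    (τ · t ⊕ v) ⊕ rest              ≈⟨ cong⊕ (wif2 t v) refl ⟩
    (τ · t ⊕ τ · (t ⊕ v)) ⊕ rest    ≈⟨ +-assoc (τ · t) (τ · (t ⊕ v)) rest ⟩
    τ · t ⊕ τ · (t ⊕ v) ⊕ rest      ∎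
    where rest = τSum′ u us

  τSum-append : ∀ t ts s ss → τSum′ t ts ⊕ τSum′ s ss ⊢≈ τSum′ t (ts ++ s ∷ ss)
  τSum-append t []       s ss = refl
  τSum-append t (u ∷ us) s ss =
    trans (+-assoc _ _ _) (cong⊕ refl (τSum-append u us s ss))

  BCCSPForm : Term → Set
  BCCSPForm t = ∃ λ t' → IsBCCSP t' × t ⊢≈ t'

  τSumForm : Term → Set
  τSumForm t = ∃ λ ts → AllBCCSP ts × t ⊢≈ τSum ts

  data Normal (t : Term) : Set where
    stable   : ¬ CanTau t → BCCSPForm t → Normal t
    unstable : CanTau t → τSumForm t → Normal t

  τSumForm-resp : ∀ {t u} → t ⊢≈ u → τSumForm u → τSumForm t
  τSumForm-resp e (ts , bts , e') = ts , bts , trans e e'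

  act-BCCSPForm : ∀ a {u} → Normal u → BCCSPForm (act a · u)
  act-BCCSPForm a (stable _ (u' , bu , e)) = act a · u' , pre a bu , cong· _ e
  act-BCCSPForm a (unstable _ ((t ∷ ts) , (bt , bts) , e)) =
    prefixSum (act a) t ts , prefixSum-BCCSP a bt bts ,
    trans (cong· _ e) (prefix-distrib (act a) t ts)

  τ-τSumForm : ∀ {u} → Normal u → τSumForm (τ · u)
  τ-τSumForm (stable _ (u' , bu , e)) = (u' ∷ []) , (bu , []) , cong· τ e
  τ-τSumForm (unstable _ ((t ∷ ts) , bts , e)) =
    (t ∷ ts) , bts ,
    trans (cong· τ e) (trans (prefix-distrib τ t ts) (≡⇒⊢≈ (prefixSum-τ t ts)))

  ⊕-τSumForm-BCCSPForm : ∀ {u v} → τSumForm u → BCCSPForm v → τSumForm (u ⊕ v)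
  ⊕-τSumForm-BCCSPForm ((t ∷ ts) , (bt , bts) , eu) (v' , bv , ev) =
    (t ∷ (t ⊕ v') ∷ ts) , (bt , sum bt bv ∷ bts) ,
    trans (cong⊕ eu ev) (τSum-absorb t ts v')

  ⊕-τSumForm-τSumForm : ∀ {u v} → τSumForm u → τSumForm v → τSumForm (u ⊕ v)
  ⊕-τSumForm-τSumForm ((t ∷ ts) , (bt , bts) , eu) ((s ∷ ss) , (bs , bss) , ev) =
    (t ∷ ts ++ s ∷ ss) , (bt , All.++⁺ bts (bs ∷ bss)) ,
    trans (cong⊕ eu ev) (τSum-append t ts s ss)

  ⊕-stable : ∀ {u v} → ¬ CanTau u → ¬ CanTau v → ¬ CanTau (u ⊕ v)
  ⊕-stable nu nv (_ , sumˡ s) = nu (_ , s)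
  ⊕-stable nu nv (_ , sumʳ s) = nv (_ , s)

  ⊕-unstableˡ : ∀ {u v} → CanTau u → CanTau (u ⊕ v)
  ⊕-unstableˡ (_ , s) = _ , sumˡ s

  ⊕-unstableʳ : ∀ {u v} → CanTau v → CanTau (u ⊕ v)
  ⊕-unstableʳ (_ , s) = _ , sumʳ s

  ⊕-Normal : ∀ {u v} → Normal u → Normal v → Normal (u ⊕ v)
  ⊕-Normal (stable nu (u' , bu , eu)) (stable nv (v' , bv , ev)) =
    stable (⊕-stable nu nv) (u' ⊕ v' , sum bu bv , cong⊕ eu ev)
  ⊕-Normal (unstable cu fu) (stable _ fv) =
    unstable (⊕-unstableˡ cu) (⊕-τSumForm-BCCSPForm fu fv)
  ⊕-Normal {u} {v} (stable _ fu) (unstable cv fv) =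
    unstable (⊕-unstableʳ cv) (τSumForm-resp (+-comm u v) (⊕-τSumForm-BCCSPForm fv fu))
  ⊕-Normal (unstable cu fu) (unstable _ fv) =
    unstable (⊕-unstableˡ cu) (⊕-τSumForm-τSumForm fu fv)

  normalise : ∀ t → Normal t
  normalise 𝟘         = stable (λ ()) (𝟘 , 𝟘 , refl)
  normalise (var n)   = stable (λ ()) (var n , var n , refl)
  normalise (act a · u) = stable (λ ()) (act-BCCSPForm a (normalise u))
  normalise (τ · u)   = unstable (_ , pref τ u) (τ-τSumForm (normalise u))
  normalise (u ⊕ v)   = ⊕-Normal (normalise u) (normalise v)

proposition3p8 : (A : Set) → A → (enc : A → ℕ) → Injective _≡_ _≡_ enc →
    (t : BCCS.Term A) →
      ((¬ BCCS.CanTau A t) → ∃ λ t' → BCCS.IsBCCSP A t' × BCCS._⊢≈_ A t t')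
      × (BCCS.CanTau A t → ∃ λ ts → BCCS.AllBCCSP A ts × BCCS._⊢≈_ A t (BCCS.τSum A ts))
proposition3p8 A _ _ _ t with Normalisation.normalise A t
... | Normalisation.stable   noτ form = (λ _ → form) , (λ canτ → ⊥-elim (noτ canτ))
... | Normalisation.unstable canτ form = (λ noτ → ⊥-elim (noτ canτ)) , (λ _ → form)
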